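{- Let $G$ be a finite graph, $r$ a positive integer, and $F$ a spanning subgraph of $G$ such that the set \[A_0:=\{v\in V(G): d_F(v)\geq \min\{r,d_G(v)\}\}\] percolates with respect to the $r$-neighbour bootstrap process on $G$. Then $F$ is weakly $(G,S_{r+1})$-saturated.
   Context: $d_F(v)$ and $d_G(v)$ denote degrees in $F$ and $G$. The $r$-neighbour bootstrap process on $G$ starts from $A_0$ and sets $A_j:=A_{j-1}\cup\{v\in V(G):|N_G(v)\cap A_{j-1}|\geq r\}$; $A_0$ percolates if $\bigcup_j A_j=V(G)$. $S_{r+1}$ is the star with $r+1$ leaves. A spanning subgraph $F$ of $G$ is weakly $(G,H)$-saturated if the edges of $E(G)\setminus E(F)$ can be added one at a time so that each added edge lies in a copy of $H$ in the current graph. -}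

module Defs where

open import Data.Nat using (ℕ; zero; suc; _+_; _≤ᵇ_; _⊓_)
open import Data.Bool using (Bool; true; false; if_then_else_; _∨_; _∧_)
open import Data.Fin using (Fin) renaming (zero to fzero; suc to fsuc)
open import Data.Fin.Properties using (_≟_)
open import Data.List using (List; map; allFin)
open import Data.Nat.ListAction using (sum)
open import Data.Product using (Σ; ∃; _×_; _,_)
open import Relation.Binary.PropositionalEquality using (_≡_)
open import Relation.Nullary.Decidable using (⌊_⌋)
open import Function.Definitions using (Injective)

record Graph (n : ℕ) : Set where
  field
    adj    : Fin n → Fin n → Bool
    sym    : ∀ u v → adj u v ≡ adj v u
    irrefl : ∀ v → adj v v ≡ false
open Graph public

degA : {n : ℕ} → (Fin n → Fin n → Bool) → Fin n → ℕ
degA {n} K v = sum (map (λ w → if K v w then 1 else 0) (allFin n))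

deg : {n : ℕ} → Graph n → Fin n → ℕ
deg G = degA (adj G)

SpanningSubgraph : {n : ℕ} → Graph n → Graph n → Set
SpanningSubgraph F G = ∀ u v → adj F u v ≡ true → adj G u v ≡ true

VSet : ℕ → Set
VSet n = Fin n → Bool

nbrsIn : {n : ℕ} → Graph n → VSet n → Fin n → ℕ
nbrsIn {n} G A v = sum (map (λ w → if adj G v w ∧ A w then 1 else 0) (allFin n))

bootstrapStep : {n : ℕ} → Graph n → ℕ → VSet n → VSet n
bootstrapStep G r A v = A v ∨ (r ≤ᵇ nbrsIn G A v)

bootstrap : {n : ℕ} → Graph n → ℕ → VSet n → ℕ → VSet n
bootstrap G r A zero    = A
bootstrap G r A (suc j) = bootstrapStep G r (bootstrap G r A j)

-- A_0 percolates: ⋃_j A_j = V(G). (The A_j are increasing, so this is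
-- equivalent to: every vertex lies in some A_j.)
Percolates : {n : ℕ} → Graph n → ℕ → VSet n → Set
Percolates {n} G r A = ∀ (v : Fin n) → ∃ λ j → bootstrap G r A j v ≡ true

-- star m: centre fzero, m leaves fsuc i; S_{r+1} = star (suc r).
star : (m : ℕ) → Graph (suc m)
star m = record { adj = a ; sym = s ; irrefl = i }
  where
  a : Fin (suc m) → Fin (suc m) → Bool
  a fzero    fzero    = false
  a fzero    (fsuc _) = true
  a (fsuc _) fzero    = true
  a (fsuc _) (fsuc _) = false
  s : ∀ u v → a u v ≡ a v u
  s fzero    fzero    = _≡_.refl
  s fzero    (fsuc _) = _≡_.refl
  s (fsuc _) fzero    = _≡_.refl
  s (fsuc _) (fsuc _) = _≡_.refl
  i : ∀ v → a v v ≡ false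
  i fzero    = _≡_.refl
  i (fsuc _) = _≡_.refl

addEdge : {n : ℕ} → (Fin n → Fin n → Bool) → Fin n → Fin n → (Fin n → Fin n → Bool)
addEdge K u v x y = K x y ∨ ((⌊ x ≟ u ⌋ ∧ ⌊ y ≟ v ⌋) ∨ (⌊ x ≟ v ⌋ ∧ ⌊ y ≟ u ⌋))

CopyThrough : {k n : ℕ} → Graph k → (Fin n → Fin n → Bool) → Fin n → Fin n → Set
CopyThrough {k} {n} H K u v =
  Σ (Fin k → Fin n) λ φ →
    Injective _≡_ _≡_ φ
    × (∀ a b → adj H a b ≡ true → K (φ a) (φ b) ≡ true)
    × ∃ λ a → ∃ λ b → adj H a b ≡ true × φ a ≡ u × φ b ≡ v

data WSatFrom {k n : ℕ} (G : Graph n) (H : Graph k) : (Fin n → Fin n → Bool) → Set where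
  done : ∀ {K} → (∀ x y → K x y ≡ adj G x y) → WSatFrom G H K
  step : ∀ {K} (u v : Fin n) → adj G u v ≡ true → K u v ≡ false →
         CopyThrough H (addEdge K u v) u v →
         WSatFrom G H (addEdge K u v) → WSatFrom G H K

WeaklySaturated : {k n : ℕ} → Graph n → Graph k → Graph n → Set
WeaklySaturated G H F = WSatFrom G H (adj F)

initialSet : {n : ℕ} → Graph n → Graph n → ℕ → VSet n
initialSet G F r v = (r ⊓ deg G v) ≤ᵇ deg F v

module Submission where

-- Grow the edge set K from E(F) towards E(G), keeping the
-- invariant F ⊆ K ⊆ G with K symmetric.  Call a non-edge uv of K (with uv an
-- edge of G) *good* if u already has at least r neighbours in K: adding it
-- creates a star S_{r+1} centred at u whose leaves are v and r old
-- K-neighbours of u, so a good edge may legally be added.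
-- The heart of the argument: for every j, either K has a good edge, or every
-- vertex of the bootstrap set A_j is *complete* in K (all its G-edges are in
-- K).  For j = 0 this follows from d_F(v) ≥ min{r, d_G(v)}; for the step, a
-- new vertex v of A_{j+1} has r G-neighbours in A_j, and these are complete,
-- so they are K-neighbours of v.  Since A_0 percolates, either K = G or a
-- good edge exists; adding good edges strictly increases |K| ≤ |G|, so the
-- process ends with K = G.

open import Defs hiding (sym)
open import Data.Nat using (ℕ; zero; suc; _+_; _≤_; _<_; z≤n; s≤s; _⊓_; _≤ᵇ_)
open import Data.Nat.Properties
  using (≤-trans; ≤-pred; ≤ᵇ⇒≤; <⇒≱; +-mono-≤; +-mono-<-≤; +-mono-≤-<; ⊓-sel; m≤m+n; +-suc; +-monoʳ-≤)
open import Data.Bool using (Bool; true; false; T; if_then_else_; _∨_; _∧_)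
open import Data.Bool.Properties using (∨-comm; ∧-comm; ∨-zeroʳ)
open import Data.Fin using (Fin) renaming (zero to fzero; suc to fsuc)
open import Data.Fin.Properties using (_≟_; suc-injective)
open import Data.List using (map; allFin; tabulate)
open import Data.List.Properties using (map-tabulate)
open import Data.Nat.ListAction using (sum)
open import Data.Product using (Σ; ∃; _×_; _,_)
open import Data.Sum using (_⊎_; inj₁; inj₂)
open import Data.Empty using (⊥-elim)
open import Data.Unit using (tt)
open import Relation.Binary.PropositionalEquality
  using (_≡_; _≢_; refl; sym; trans; cong; cong₂; subst; subst₂)
open import Relation.Nullary.Decidable using (⌊_⌋; yes; no; dec-true; isYes≗does)
open import Function.Definitions using (Injective)

∑ : {n : ℕ} → (Fin n → ℕ) → ℕ
∑ f = sum (tabulate f)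

∑-mono : {n : ℕ} (f g : Fin n → ℕ) → (∀ i → f i ≤ g i) → ∑ f ≤ ∑ g
∑-mono {zero}  f g f≤g = z≤n
∑-mono {suc n} f g f≤g =
  +-mono-≤ (f≤g fzero) (∑-mono (λ i → f (fsuc i)) (λ i → g (fsuc i)) (λ i → f≤g (fsuc i)))

∑-strict : {n : ℕ} (f g : Fin n → ℕ) → (∀ i → f i ≤ g i) → (i₀ : Fin n) → f i₀ < g i₀ →
           ∑ f < ∑ g
∑-strict {suc n} f g f≤g fzero     lt =
  +-mono-<-≤ lt (∑-mono (λ i → f (fsuc i)) (λ i → g (fsuc i)) (λ i → f≤g (fsuc i)))
∑-strict {suc n} f g f≤g (fsuc i₀) lt =
  +-mono-≤-< (f≤g fzero) (∑-strict (λ i → f (fsuc i)) (λ i → g (fsuc i)) (λ i → f≤g (fsuc i)) i₀ lt)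

indicator : Bool → ℕ
indicator b = if b then 1 else 0

count : {n : ℕ} → (Fin n → Bool) → ℕ
count P = ∑ (λ i → indicator (P i))

count-allFin : {n : ℕ} (P : Fin n → Bool) →
               sum (map (λ w → if P w then 1 else 0) (allFin n)) ≡ count P
count-allFin P = cong sum (map-tabulate (λ i → i) (λ w → if P w then 1 else 0))

indicator-mono : (a b : Bool) → (a ≡ true → b ≡ true) → indicator a ≤ indicator b
indicator-mono false b a⇒b = z≤n
indicator-mono true  b a⇒b with a⇒b refl
... | refl = s≤s z≤n

count-mono : {n : ℕ} (P Q : Fin n → Bool) → (∀ i → P i ≡ true → Q i ≡ true) →
             count P ≤ count Q
count-mono P Q P⇒Q = ∑-mono _ _ (λ i → indicator-mono (P i) (Q i) (P⇒Q i))

count-strict : {n : ℕ} (P Q : Fin n → Bool) → (∀ i → P i ≡ true → Q i ≡ true) →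
               (i₀ : Fin n) → P i₀ ≡ false → Q i₀ ≡ true → count P < count Q
count-strict P Q P⇒Q i₀ p q = ∑-strict _ _ (λ i → indicator-mono (P i) (Q i) (P⇒Q i)) i₀ lt
  where
  lt : indicator (P i₀) < indicator (Q i₀)
  lt rewrite p | q = s≤s z≤n

choose : {n : ℕ} (P : Fin n → Bool) (r : ℕ) → r ≤ count P →
         Σ (Fin r → Fin n) λ f → Injective _≡_ _≡_ f × (∀ i → P (f i) ≡ true)
choose         P zero    _ = (λ ()) , (λ { {()} }) , (λ ())
choose {zero}  P (suc r) ()
choose {suc n} P (suc r) r<P with P fzero in P0
... | false =
  let (f , f-inj , f∈P) = choose (λ i → P (fsuc i)) (suc r) r<P
  in (λ i → fsuc (f i)) , (λ e → f-inj (suc-injective e)) , f∈P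
... | true =
  let (f , f-inj , f∈P) = choose (λ i → P (fsuc i)) r (≤-pred r<P)
      g : Fin (suc r) → Fin (suc n)
      g = λ { fzero → fzero ; (fsuc i) → fsuc (f i) }
      g-inj : Injective _≡_ _≡_ g
      g-inj = λ { {fzero} {fzero} _ → refl
                ; {fsuc i} {fsuc j} e → cong fsuc (f-inj (suc-injective e)) }
  in g , g-inj , λ { fzero → P0 ; (fsuc i) → f∈P i }

all-or-exists : {n : ℕ} {P Q : Fin n → Set} → (∀ i → P i ⊎ Q i) → (∀ i → P i) ⊎ ∃ Q
all-or-exists {zero}  d = inj₁ (λ ())
all-or-exists {suc n} d with d fzero | all-or-exists (λ i → d (fsuc i))
... | inj₂ q | _            = inj₂ (fzero , q)
... | inj₁ _ | inj₂ (i , q) = inj₂ (fsuc i , q)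
... | inj₁ p | inj₁ ps      = inj₁ λ { fzero → p ; (fsuc i) → ps i }

Rel : ℕ → Set
Rel n = Fin n → Fin n → Bool

_⊆ᴿ_ : {n : ℕ} → Rel n → Rel n → Set
K ⊆ᴿ L = ∀ x y → K x y ≡ true → L x y ≡ true

Symmetric : {n : ℕ} → Rel n → Set
Symmetric K = ∀ x y → K x y ≡ K y x

∨-trueˡ : (a b : Bool) → a ≡ true → a ∨ b ≡ true
∨-trueˡ true b _ = refl

⌊≟⌋-refl : {n : ℕ} (x : Fin n) → ⌊ x ≟ x ⌋ ≡ true
⌊≟⌋-refl x = trans (isYes≗does (x ≟ x)) (dec-true (x ≟ x) refl)

addEdge-⊇ : {n : ℕ} (K : Rel n) (u v : Fin n) → K ⊆ᴿ addEdge K u v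
addEdge-⊇ K u v x y e = ∨-trueˡ (K x y) _ e

addEdge-uv : {n : ℕ} (K : Rel n) (u v : Fin n) → addEdge K u v u v ≡ true
addEdge-uv K u v rewrite ⌊≟⌋-refl u | ⌊≟⌋-refl v = ∨-zeroʳ (K u v)

addEdge-vu : {n : ℕ} (K : Rel n) (u v : Fin n) → addEdge K u v v u ≡ true
addEdge-vu K u v rewrite ⌊≟⌋-refl u | ⌊≟⌋-refl v =
  trans (cong (K v u ∨_) (∨-zeroʳ _)) (∨-zeroʳ (K v u))

addEdge-⊆ : {n : ℕ} (K L : Rel n) (u v : Fin n) → K ⊆ᴿ L → L u v ≡ true → L v u ≡ true →
            addEdge K u v ⊆ᴿ L
addEdge-⊆ K L u v K⊆L uv vu x y e with K x y in Kxy | x ≟ u | y ≟ v | x ≟ v | y ≟ u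
... | true  | _        | _        | _        | _        = K⊆L x y Kxy
... | false | yes refl | yes refl | _        | _        = uv
... | false | _        | _        | yes refl | yes refl = vu
addEdge-⊆ K L u v K⊆L uv vu x y () | false | no _  | _     | no _  | _
addEdge-⊆ K L u v K⊆L uv vu x y () | false | no _  | _     | yes _ | no _
addEdge-⊆ K L u v K⊆L uv vu x y () | false | yes _ | no _  | no _  | _
addEdge-⊆ K L u v K⊆L uv vu x y () | false | yes _ | no _  | yes _ | no _

addEdge-sym : {n : ℕ} (K : Rel n) (u v : Fin n) → Symmetric K → Symmetric (addEdge K u v)
addEdge-sym K u v K-sym x y = cong₂ _∨_ (K-sym x y) swap-disjuncts
  where
  swap-disjuncts : (⌊ x ≟ u ⌋ ∧ ⌊ y ≟ v ⌋) ∨ (⌊ x ≟ v ⌋ ∧ ⌊ y ≟ u ⌋)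
                 ≡ (⌊ y ≟ u ⌋ ∧ ⌊ x ≟ v ⌋) ∨ (⌊ y ≟ v ⌋ ∧ ⌊ x ≟ u ⌋)
  swap-disjuncts = trans (∨-comm (⌊ x ≟ u ⌋ ∧ ⌊ y ≟ v ⌋) _)
                         (cong₂ _∨_ (∧-comm (⌊ x ≟ v ⌋) _) (∧-comm (⌊ x ≟ u ⌋) _))

-- The number of (ordered) pairs in a relation: twice the number of edges.
size : {n : ℕ} → Rel n → ℕ
size K = ∑ (λ x → count (K x))

size-mono : {n : ℕ} (K L : Rel n) → K ⊆ᴿ L → size K ≤ size L
size-mono K L K⊆L = ∑-mono _ _ (λ x → count-mono (K x) (L x) (K⊆L x))

size-addEdge : {n : ℕ} (K : Rel n) (u v : Fin n) → K u v ≡ false → size K < size (addEdge K u v)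
size-addEdge K u v Kuv =
  ∑-strict _ _ (λ x → count-mono (K x) _ (addEdge-⊇ K u v x)) u
    (count-strict (K u) _ (addEdge-⊇ K u v u) v Kuv (addEdge-uv K u v))

true≢false : true ≢ false
true≢false ()

starCopy : {n r : ℕ} (K : Rel n) (u v : Fin n) → Symmetric K → K u u ≡ false → u ≢ v →
           K u v ≡ false → r ≤ count (K u) → CopyThrough (star (suc r)) (addEdge K u v) u v
starCopy {n} {r} K u v K-sym Kuu u≢v Kuv r≤deg with choose (K u) r r≤deg
... | (f , f-inj , f∈N) = φ , φ-inj , φ-edges , fzero , fsuc fzero , refl , refl , refl
  where
  φ : Fin (suc (suc r)) → Fin n
  φ fzero           = u
  φ (fsuc fzero)    = v
  φ (fsuc (fsuc i)) = f i

  u≢f : ∀ i → u ≢ f i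
  u≢f i e = true≢false (trans (sym (f∈N i)) (trans (cong (K u) (sym e)) Kuu))
  v≢f : ∀ i → v ≢ f i
  v≢f i e = true≢false (trans (sym (f∈N i)) (trans (cong (K u) (sym e)) Kuv))

  φ-inj : Injective _≡_ _≡_ φ
  φ-inj {fzero}           {fzero}           _ = refl
  φ-inj {fzero}           {fsuc fzero}      e = ⊥-elim (u≢v e)
  φ-inj {fzero}           {fsuc (fsuc j)}   e = ⊥-elim (u≢f j e)
  φ-inj {fsuc fzero}      {fzero}           e = ⊥-elim (u≢v (sym e))
  φ-inj {fsuc fzero}      {fsuc fzero}      _ = refl
  φ-inj {fsuc fzero}      {fsuc (fsuc j)}   e = ⊥-elim (v≢f j e)
  φ-inj {fsuc (fsuc i)}   {fzero}           e = ⊥-elim (u≢f i (sym e))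
  φ-inj {fsuc (fsuc i)}   {fsuc fzero}      e = ⊥-elim (v≢f i (sym e))
  φ-inj {fsuc (fsuc i)}   {fsuc (fsuc j)}   e = cong (λ k → fsuc (fsuc k)) (f-inj e)

  φ-edges : ∀ a b → adj (star (suc r)) a b ≡ true → addEdge K u v (φ a) (φ b) ≡ true
  φ-edges fzero           (fsuc fzero)    _ = addEdge-uv K u v
  φ-edges fzero           (fsuc (fsuc i)) _ = addEdge-⊇ K u v u (f i) (f∈N i)
  φ-edges (fsuc fzero)    fzero           _ = addEdge-vu K u v
  φ-edges (fsuc (fsuc i)) fzero           _ = addEdge-⊇ K u v (f i) u (trans (K-sym (f i) u) (f∈N i))

≤ᵇ-true : {m k : ℕ} → (m ≤ᵇ k) ≡ true → m ≤ k
≤ᵇ-true {m} {k} e = ≤ᵇ⇒≤ m k (subst T (sym e) tt)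

min-bound : (r g k : ℕ) → r ⊓ g ≤ k → k < g → r ≤ k
min-bound r g k min≤k k<g with ⊓-sel r g
... | inj₁ r⊓g≡r = subst (_≤ k) r⊓g≡r min≤k
... | inj₂ r⊓g≡g = ⊥-elim (<⇒≱ k<g (subst (_≤ k) r⊓g≡g min≤k))

module Saturation {n : ℕ} (G F : Graph n) (r : ℕ) where

  record Between (K : Rel n) : Set where
    field
      F⊆K   : adj F ⊆ᴿ K
      K⊆G   : K ⊆ᴿ adj G
      K-sym : Symmetric K
  open Between

  Complete : Rel n → Fin n → Set
  Complete K v = ∀ w → adj G v w ≡ true → K v w ≡ true

  Missing : Rel n → Fin n → Set
  Missing K v = ∃ λ w → adj G v w ≡ true × K v w ≡ false

  record GoodEdge (K : Rel n) : Set where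
    constructor good
    field
      u v  : Fin n
      Guv  : adj G u v ≡ true
      Kuv  : K u v ≡ false
      rich : r ≤ count (K u)

  complete-or-missing : (K : Rel n) (v : Fin n) → Complete K v ⊎ Missing K v
  complete-or-missing K v = all-or-exists test
    where
    test : ∀ w → (adj G v w ≡ true → K v w ≡ true) ⊎ (adj G v w ≡ true × K v w ≡ false)
    test w with adj G v w | K v w
    ... | false | _     = inj₁ (λ ())
    ... | true  | true  = inj₁ (λ _ → refl)
    ... | true  | false = inj₂ (refl , refl)

  missing-degree : {K : Rel n} → Between K → (v : Fin n) → Missing K v →
                   count (K v) < count (adj G v)
  missing-degree inv v (w , Gvw , Kvw) = count-strict _ _ (K⊆G inv v) w Kvw Gvw

  complete-or-good : (K : Rel n) (A : VSet n) →
                     (∀ v → A v ≡ true → Missing K v → r ≤ count (K v)) →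
                     (∀ v → A v ≡ true → Complete K v) ⊎ GoodEdge K
  complete-or-good K A rich with all-or-exists test
    where
    test : ∀ v → (A v ≡ true → Complete K v) ⊎ (A v ≡ true × Missing K v)
    test v with A v | complete-or-missing K v
    ... | false | _      = inj₁ (λ ())
    ... | true  | inj₁ c = inj₁ (λ _ → c)
    ... | true  | inj₂ m = inj₂ (refl , m)
  ... | inj₁ complete                       = inj₁ complete
  ... | inj₂ (v , Av , m@(w , Gvw , Kvw)) = inj₂ (good v w Gvw Kvw (rich v Av m))

  A₀ : VSet n
  A₀ = initialSet G F r

  -- Vertices of A₀: d_K(v) ≥ d_F(v) ≥ min{r, d_G(v)}.
  initial-rich : {K : Rel n} → Between K →
                 ∀ v → A₀ v ≡ true → Missing K v → r ≤ count (K v)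
  initial-rich {K} inv v A₀v m =
    min-bound r (count (adj G v)) (count (K v))
      (≤-trans min≤dF (count-mono _ _ (F⊆K inv v)))
      (missing-degree inv v m)
    where
    min≤dF : r ⊓ count (adj G v) ≤ count (adj F v)
    min≤dF = subst₂ (λ dG dF → r ⊓ dG ≤ dF) (count-allFin (adj G v)) (count-allFin (adj F v))
                    (≤ᵇ-true A₀v)

  complete-neighbours : {K : Rel n} → Between K → (A : VSet n) →
                        (∀ v → A v ≡ true → Complete K v) →
                        ∀ v → nbrsIn G A v ≤ count (K v)
  complete-neighbours {K} inv A complete v =
    subst (_≤ count (K v)) (sym (count-allFin (λ w → adj G v w ∧ A w))) (count-mono _ _ nbr⇒K)
    where
    nbr⇒K : ∀ w → (adj G v w ∧ A w) ≡ true → K v w ≡ true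
    nbr⇒K w e with adj G v w in Gvw | A w in Aw
    nbr⇒K w () | false | _
    nbr⇒K w () | true  | false
    nbr⇒K w _  | true  | true =
      trans (K-sym inv v w) (complete w Aw v (trans (Graph.sym G w v) Gvw))

  -- A vertex entering in the bootstrap step has r complete K-neighbours.
  step-rich : {K : Rel n} → Between K → (A : VSet n) → (∀ v → A v ≡ true → Complete K v) →
              ∀ v → bootstrapStep G r A v ≡ true → Missing K v → r ≤ count (K v)
  step-rich inv A complete v e (w , Gvw , Kvw) with A v in Av
  ... | true  = ⊥-elim (true≢false (trans (sym (complete v Av w Gvw)) Kvw))
  ... | false = ≤-trans (≤ᵇ-true e) (complete-neighbours inv A complete v)

  bootstrap-complete : {K : Rel n} → Between K → (j : ℕ) →
                       (∀ v → bootstrap G r A₀ j v ≡ true → Complete K v) ⊎ GoodEdge K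
  bootstrap-complete {K} inv zero = complete-or-good K A₀ (initial-rich inv)
  bootstrap-complete {K} inv (suc j) with bootstrap-complete inv j
  ... | inj₂ g        = inj₂ g
  ... | inj₁ complete = complete-or-good K _ (step-rich inv _ complete)

  equal-or-good : Percolates G r A₀ → {K : Rel n} → Between K →
                  (∀ x y → K x y ≡ adj G x y) ⊎ GoodEdge K
  equal-or-good perc {K} inv with all-or-exists vertex-test
    where
    vertex-test : ∀ v → Complete K v ⊎ GoodEdge K
    vertex-test v with perc v
    ... | (j , v∈Aj) with bootstrap-complete inv j
    ...   | inj₁ complete = inj₁ (complete v v∈Aj)
    ...   | inj₂ g        = inj₂ g
  ... | inj₂ (_ , g)   = inj₂ g
  ... | inj₁ complete = inj₁ K≡G
    where
    K≡G : ∀ x y → K x y ≡ adj G x y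
    K≡G x y with adj G x y in Gxy | K x y in Kxy
    ... | true  | true  = refl
    ... | false | false = refl
    ... | true  | false = ⊥-elim (true≢false (trans (sym (complete x y Gxy)) Kxy))
    ... | false | true  = ⊥-elim (true≢false (trans (sym (K⊆G inv x y Kxy)) Gxy))

  no-loop : {K : Rel n} → Between K → (x : Fin n) → K x x ≡ false
  no-loop {K} inv x with K x x in Kxx
  ... | false = refl
  ... | true  = ⊥-elim (true≢false (trans (sym (K⊆G inv x x Kxx)) (irrefl G x)))

  edge-ends-differ : {x y : Fin n} → adj G x y ≡ true → x ≢ y
  edge-ends-differ {x} Gxy refl = true≢false (trans (sym Gxy) (irrefl G x))

  add-between : {K : Rel n} → Between K → (u v : Fin n) → adj G u v ≡ true →
                Between (addEdge K u v)
  add-between {K} inv u v Guv = record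
    { F⊆K   = λ x y e → addEdge-⊇ K u v x y (F⊆K inv x y e)
    ; K⊆G   = addEdge-⊆ K (adj G) u v (K⊆G inv) Guv (trans (Graph.sym G v u) Guv)
    ; K-sym = addEdge-sym K u v (K-sym inv)
    }

  -- Adding good edges until K = G; the budget bounds the number of missing
  -- (ordered) pairs, which drops with every added edge.
  saturate : Percolates G r A₀ → (budget : ℕ) (K : Rel n) → Between K →
             size (adj G) ≤ budget + size K → WSatFrom G (star (suc r)) K
  saturate perc budget K inv bound with equal-or-good perc inv
  ... | inj₁ K≡G = done K≡G
  ... | inj₂ (good u v Guv Kuv rich) =
    step u v Guv Kuv
      (starCopy K u v (K-sym inv) (no-loop inv u) (edge-ends-differ Guv) Kuv rich)
      (continue budget bound)
    where
    K' = addEdge K u v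
    inv' : Between K'
    inv' = add-between inv u v Guv
    grows : size K < size K'
    grows = size-addEdge K u v Kuv
    continue : (b : ℕ) → size (adj G) ≤ b + size K → WSatFrom G (star (suc r)) K'
    continue zero    bound = ⊥-elim (<⇒≱ grows (≤-trans (size-mono K' (adj G) (K⊆G inv')) bound))
    continue (suc b) bound = saturate perc b K' inv'
      (≤-trans bound (subst (_≤ b + size K') (+-suc b (size K)) (+-monoʳ-≤ b grows)))

lemma2p1 : (n r : ℕ) → 1 ≤ r → (G F : Graph n) → SpanningSubgraph F G →
           Percolates G r (initialSet G F r) →
           WeaklySaturated G (star (suc r)) F
lemma2p1 n r _ G F F⊆G perc =
  saturate perc (size (adj G)) (adj F) F-between (m≤m+n (size (adj G)) (size (adj F)))
  where
  open Saturation G F r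
  F-between : Between (adj F)
  F-between = record { F⊆K = λ x y e → e ; K⊆G = F⊆G ; K-sym = Graph.sym F }
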